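{- Let $(\mathscr{O},\eta,e)$ be an operad. Then $(\mathscr{O}',\mathscr{O})$ with product $(\rho,\eta)$, where $\rho=\eta'$, and identity $(\mathfrak{e},e)$, where $\mathfrak{e}=e'$, is a monop.
   Context: Species, product $\cdot$, substitution $R(P)$ (for $P$ positive), species $1$ and $X$, operads $(\mathscr O,\eta:\mathscr O(\mathscr O)\to\mathscr O, e:X\to\mathscr O)$ are as usual in the theory of combinatorial species: $(M\cdot N)[V]=\sum_{V_1+V_2=V}M[V_1]\times N[V_2]$; $R(P)[V]=\sum_{\pi}(\prod_{B\in\pi}P[B])\times R[\pi]$ over partitions $\pi$ of $V$; $1[\emptyset]=\{\emptyset\}$, $1[V]=\emptyset$ for $V\neq\emptyset$; $X[V]=V$ if $|V|=1$, else $\emptyset$; an operad is a monoid for substitution on positive species (associative product $\eta$ with two-sided unit $e$). The derivative of a species $F$ is $F'[V]=F[V+\{\ast\}]$ ($\ast$ a new point), and of a morphism $\phi$ is $\phi'_V=\phi_{V+\{\ast\}}$. By the chain rule $(\mathscr{O}(\mathscr{O}))'\cong\mathscr{O}'(\mathscr{O})\cdot\mathscr{O}'\cong\mathscr{O}'\cdot\mathscr{O}'(\mathscr{O})$ and $X'\cong 1$, so $\eta'$ is regarded as a morphism $\mathscr{O}'\cdot\mathscr{O}'(\mathscr{O})\to\mathscr{O}'$ and $e'$ as a morphism $1\to\mathscr{O}'$. Riordan category: objects are pairs $(M,\mathscr{O})$ of species with $\mathscr{O}$ positive; monoidal product $(M_1,\mathscr{O}_1)\ast(M_2,\mathscr{O}_2)=(M_1\cdot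 M_2(\mathscr{O}_1),\mathscr{O}_2(\mathscr{O}_1))$, on morphisms $(\phi_1,\psi_1)\ast(\phi_2,\psi_2)=(\phi_1\cdot\phi_2(\psi_1),\psi_2(\psi_1))$, unit $(1,X)$; associativity isomorphism: associativity of substitution in the second component, and in the first component associativity of product composed with the canonical isomorphisms $(A\cdot B)(C)\cong A(C)\cdot B(C)$, $A(B)(C)\cong A(B(C))$. A monop is a monoid in this category, i.e. a pair $(M,\mathscr{O})$ with $(\rho,\eta):(M,\mathscr{O})\ast(M,\mathscr{O})\to(M,\mathscr{O})$ and $(\mathfrak{e},e):(1,X)\to(M,\mathscr{O})$ satisfying the monoid associativity and unit axioms. -}

module Defs where

open import Data.Empty using (⊥; ⊥-elim)
open import Data.Unit using (⊤; tt)
open import Data.Sum using (_⊎_; inj₁; inj₂)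
open import Data.Product using (Σ; _,_; proj₁; proj₂; _×_)
open import Function using (_∘_; id)
open import Function.Bundles using (_↔_; Inverse; mk↔ₛ′)
open import Function.Construct.Composition using (_↔-∘_)
open import Function.Construct.Identity using (↔-id)
open import Function.Properties.Inverse using (↔-sym)
open import Data.Sum.Function.Propositional using (_⊎-↔_)
open import Data.Product.Function.Dependent.Propositional using (Σ-↔)
open import Function.Related.TypeIsomorphisms using (Σ-assoc; ⊎-assoc; ⊎-comm; Σ-distribʳ-⊎)
open import Relation.Binary.PropositionalEquality using (_≡_; refl; sym; trans; cong)

-- A (small) universe of finite sets: every El U is finite, and every
-- finite set is in bijection with some El U.  The category of codes with
-- bijections El U ↔ El V is thus equivalent to the category B of finite
-- sets and bijections on which species are defined.

data Code : Set
El : Code → Set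

data Code where
  ∅c 𝟙c : Code
  _⊕_   : Code → Code → Code
  σ     : (A : Code) → (El A → Code) → Code

El ∅c      = ⊥
El 𝟙c      = ⊤
El (A ⊕ B) = El A ⊎ El B
El (σ A B) = Σ (El A) (λ a → El (B a))

open Inverse using (to; from)

-- A species is a functor from finite sets with bijections to Set:
-- structures F U, transport tr along bijections, with functor laws.
-- (tr-ext: transport only depends on the underlying function of the
-- bijection; automatic in set theory, needed here without funext.)

record Species : Set₁ where
  field
    F      : Code → Set
    tr     : ∀ {U V} → El U ↔ El V → F U → F V
    tr-id  : ∀ {U} (x : F U) → tr (↔-id _) x ≡ x
    tr-∘   : ∀ {U V W} (f : El U ↔ El V) (g : El V ↔ El W) (x : F U) →
             tr (g ↔-∘ f) x ≡ tr g (tr f x)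
    tr-ext : ∀ {U V} (f g : El U ↔ El V) → (∀ u → to f u ≡ to g u) →
             ∀ (x : F U) → tr f x ≡ tr g x

-- Species built by product / substitution are sums over decompositions
-- of the label set; we represent a decomposition by data "up to
-- bijection", so their structures carry an explicit equality relation
-- (identifying two representations of the same decomposition).

record RawSpecies : Set₁ where
  field
    F   : Code → Set
    _≈_ : ∀ {U} → F U → F U → Set
    tr  : ∀ {U V} → El U ↔ El V → F U → F V

open RawSpecies

raw : Species → RawSpecies
raw S = record { F = Species.F S ; _≈_ = _≡_ ; tr = Species.tr S }

Positive : Species → Set
Positive S = Species.F S ∅c → ⊥

Map : RawSpecies → RawSpecies → Set
Map M N = ∀ {U} → F M U → F N U

record IsMorphism (M N : RawSpecies) (f : Map M N) : Set where
  field
    resp    : ∀ {U} {x y : F M U} → _≈_ M x y → _≈_ N (f x) (f y)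
    natural : ∀ {U V} (α : El U ↔ El V) (x : F M U) →
              _≈_ N (f (tr M α x)) (tr N α (f x))

-- 1[V] = {∅} if V = ∅, empty otherwise (all elements are equal).
One : RawSpecies
One = record
  { F   = λ U → El U → ⊥
  ; _≈_ = λ _ _ → ⊤
  ; tr  = λ f u → u ∘ from f }

-- X[V] = V if |V| = 1, empty otherwise.
XStr : Code → Set
XStr U = Σ (El U) (λ a → ∀ b → b ≡ a)

X : RawSpecies
X = record
  { F   = XStr
  ; _≈_ = λ x y → proj₁ x ≡ proj₁ y
  ; tr  = λ f x → to f (proj₁ x) ,
            λ b → trans (sym (Inverse.strictlyInverseˡ f b))
                        (cong (to f) (proj₂ x (from f b))) }

record Prod₀ (M N : RawSpecies) (V : Code) : Set where
  constructor prod
  field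
    V₁ V₂ : Code
    split : (El V₁ ⊎ El V₂) ↔ El V
    left  : F M V₁
    right : F N V₂

_·_ : RawSpecies → RawSpecies → RawSpecies
M · N = record
  { F   = Prod₀ M N
  ; _≈_ = λ { (prod V₁ V₂ s m n) (prod W₁ W₂ s' m' n') →
      Σ (El V₁ ↔ El W₁) λ α₁ → Σ (El V₂ ↔ El W₂) λ α₂ →
        (∀ x → to s' (to (α₁ ⊎-↔ α₂) x) ≡ to s x)
        × _≈_ M (tr M α₁ m) m' × _≈_ N (tr N α₂ n) n' }
  ; tr  = λ { f (prod V₁ V₂ s m n) → prod V₁ V₂ (f ↔-∘ s) m n } }

-- Substitution  R(P)[V] = Σ_π (Π_{B∈π} P[B]) × R[π]
-- A partition of V: a set of blocks I, the blocks B i, and a bijection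
-- Σ_i B i ≅ V.  (Blocks are not required to be nonempty; for positive P,
-- the only case in which substitution is used, this makes no difference.)

record Subst₀ (R P : RawSpecies) (V : Code) : Set where
  constructor subst
  field
    I     : Code
    B     : El I → Code
    glue  : Σ (El I) (λ i → El (B i)) ↔ El V
    inner : (i : El I) → F P (B i)
    outer : F R I

_⊚_ : RawSpecies → RawSpecies → RawSpecies
R ⊚ P = record
  { F   = Subst₀ R P
  ; _≈_ = λ { (subst I B g p r) (subst I' B' g' p' r') →
      Σ (El I ↔ El I') λ α → Σ (∀ i → El (B i) ↔ El (B' (to α i))) λ γ →
        (∀ i b → to g' (to α i , to (γ i) b) ≡ to g (i , b))
        × (∀ i → _≈_ P (tr P (γ i) (p i)) (p' (to α i)))
        × _≈_ R (tr R α r) r' }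
  ; tr  = λ { f (subst I B g p r) → subst I B (f ↔-∘ g) p r } }

-- Derivative  F'[V] = F[V + {*}]   (* = inj₂ tt)

_′ : RawSpecies → RawSpecies
M ′ = record
  { F   = λ U → F M (U ⊕ 𝟙c)
  ; _≈_ = _≈_ M
  ; tr  = λ f → tr M (f ⊎-↔ (↔-id _)) }

prodMap : ∀ {M N M' N'} → Map M M' → Map N N' → Map (M · N) (M' · N')
prodMap f g (prod V₁ V₂ s m n) = prod V₁ V₂ s (f m) (g n)

substMap : ∀ {R P R' P'} → Map R R' → Map P P' → Map (R ⊚ P) (R' ⊚ P')
substMap φ ψ (subst I B g p r) = subst I B g (λ i → ψ (p i)) (φ r)

idMap : ∀ {M} → Map M M
idMap x = x

·-assoc : ∀ {A B C} → Map ((A · B) · C) (A · (B · C))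
·-assoc (prod W V₃ s (prod V₁ V₂ t a b) c) =
  prod V₁ (V₂ ⊕ V₃)
       (s ↔-∘ ((t ⊎-↔ (↔-id _)) ↔-∘ ↔-sym (⊎-assoc _ _ _ _)))
       a (prod V₂ V₃ (↔-id _) b c)

⊚-assoc : ∀ {A B C} → Map ((A ⊚ B) ⊚ C) (A ⊚ (B ⊚ C))
⊚-assoc {A} {B} {C} (subst I Bl β p (subst J Cl γ q s)) =
  subst J K δ t s
  where
    K : El J → Code
    K j = σ (Cl j) (λ c → Bl (to γ (j , c)))
    δ : Σ (El J) (λ j → El (K j)) ↔ El _
    δ = β ↔-∘ (Σ-↔ γ (↔-id _) ↔-∘ ↔-sym Σ-assoc)
    t : (j : El J) → F (B ⊚ C) (K j)
    t j = subst (Cl j) (λ c → Bl (to γ (j , c))) (↔-id _)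
                (λ c → p (to γ (j , c))) (q j)

⊚-assoc⁻ : ∀ {A B C} → Map (A ⊚ (B ⊚ C)) ((A ⊚ B) ⊚ C)
⊚-assoc⁻ {A} {B} {C} (subst J K δ t s) =
  subst (σ J L) Bl' β p (subst J L (↔-id _) w s)
  where
    L : El J → Code
    L j = Subst₀.I (t j)
    Bl' : El (σ J L) → Code
    Bl' (j , l) = Subst₀.B (t j) l
    β : Σ (El (σ J L)) (λ i → El (Bl' i)) ↔ El _
    β = δ ↔-∘ (Σ-↔ (↔-id _) (λ {j} → Subst₀.glue (t j)) ↔-∘ Σ-assoc)
    p : (i : El (σ J L)) → F C (Bl' i)
    p (j , l) = Subst₀.inner (t j) l
    w : (j : El J) → F B (L j)
    w j = Subst₀.outer (t j)

⊚-distrib⁻ : ∀ {A B C} → Map ((A ⊚ C) · (B ⊚ C)) ((A · B) ⊚ C)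
⊚-distrib⁻ {A} {B} {C}
  (prod V₁ V₂ s (subst I₁ B₁ β₁ p₁ a) (subst I₂ B₂ β₂ p₂ b)) =
  subst (I₁ ⊕ I₂) Bl β p (prod I₁ I₂ (↔-id _) a b)
  where
    Bl : El (I₁ ⊕ I₂) → Code
    Bl (inj₁ i) = B₁ i
    Bl (inj₂ i) = B₂ i
    β : Σ (El (I₁ ⊕ I₂)) (λ i → El (Bl i)) ↔ El _
    β = s ↔-∘ ((β₁ ⊎-↔ β₂) ↔-∘ Σ-distribʳ-⊎)
    p : (i : El (I₁ ⊕ I₂)) → F C (Bl i)
    p (inj₁ i) = p₁ i
    p (inj₂ i) = p₂ i

ιX⊚ : ∀ {M} → Map M (X ⊚ M)
ιX⊚ {M} {U} x = subst 𝟙c (λ _ → U) g (λ _ → x) (tt , λ { tt → refl })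
  where
    g : Σ ⊤ (λ _ → El U) ↔ El U
    g = mk↔ₛ′ proj₂ (tt ,_) (λ _ → refl) (λ _ → refl)

ι⊚X : ∀ {M} → Map M (M ⊚ X)
ι⊚X {M} {U} x = subst U (λ _ → 𝟙c) g (λ _ → tt , λ { tt → refl }) x
  where
    g : Σ (El U) (λ _ → ⊤) ↔ El U
    g = mk↔ₛ′ proj₁ (_, tt) (λ _ → refl) (λ _ → refl)

ι1· : ∀ {M} → Map M (One · (M ⊚ X))
ι1· {M} {U} x = prod ∅c U g (λ ()) (ι⊚X {M} x)
  where
    g : (⊥ ⊎ El U) ↔ El U
    g = mk↔ₛ′ (λ { (inj₁ ()) ; (inj₂ u) → u }) inj₂ (λ _ → refl) (λ { (inj₁ ()) ; (inj₂ _) → refl })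

noB : ⊥ → Code
noB ()

ι·1 : ∀ {M O} → Map M (M · (One ⊚ O))
ι·1 {M} {O} {U} x = prod U ∅c g x (subst ∅c noB e (λ ()) (λ ()))
  where
    g : (El U ⊎ ⊥) ↔ El U
    g = mk↔ₛ′ (λ { (inj₁ u) → u ; (inj₂ ()) }) inj₁ (λ _ → refl) (λ { (inj₁ _) → refl ; (inj₂ ()) })
    e : Σ ⊥ (λ i → El (noB i)) ↔ ⊥
    e = mk↔ₛ′ (λ { (() , _) }) (λ ()) (λ ()) (λ { (() , _) })

record Operad : Set₁ where
  field
    O        : Species
    positive : Positive O
  𝒪 : RawSpecies
  𝒪 = raw O
  field
    η       : Map (𝒪 ⊚ 𝒪) 𝒪
    e       : Map X 𝒪
    η-morph : IsMorphism (𝒪 ⊚ 𝒪) 𝒪 η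
    e-morph : IsMorphism X 𝒪 e
    assoc   : ∀ {U} (x : F ((𝒪 ⊚ 𝒪) ⊚ 𝒪) U) →
              η (substMap {𝒪 ⊚ 𝒪} {𝒪} {𝒪} {𝒪} η (idMap {𝒪}) x)
              ≡ η (substMap {𝒪} {𝒪 ⊚ 𝒪} {𝒪} {𝒪} (idMap {𝒪}) η
                            (⊚-assoc {𝒪} {𝒪} {𝒪} x))
    unitˡ   : ∀ {U} (x : Species.F O U) →
              η (substMap {X} {𝒪} {𝒪} {𝒪} e (idMap {𝒪}) (ιX⊚ {𝒪} x)) ≡ x
    unitʳ   : ∀ {U} (x : Species.F O U) →
              η (substMap {𝒪} {X} {𝒪} {𝒪} (idMap {𝒪}) e (ι⊚X {𝒪} x)) ≡ x

Obj : Set₁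
Obj = RawSpecies × RawSpecies

_∗_ : Obj → Obj → Obj
(M₁ , O₁) ∗ (M₂ , O₂) = (M₁ · (M₂ ⊚ O₁)) , (O₂ ⊚ O₁)

Hom : Obj → Obj → Set
Hom (M₁ , O₁) (M₂ , O₂) = Map M₁ M₂ × Map O₁ O₂

_∗ₘ_ : ∀ {A₁ A₂ B₁ B₂} → Hom A₁ B₁ → Hom A₂ B₂ → Hom (A₁ ∗ A₂) (B₁ ∗ B₂)
_∗ₘ_ {M₁ , O₁} {M₂ , O₂} {N₁ , P₁} {N₂ , P₂} (φ₁ , ψ₁) (φ₂ , ψ₂) =
    prodMap {M₁} {M₂ ⊚ O₁} {N₁} {N₂ ⊚ P₁} φ₁ (substMap {M₂} {O₁} {N₂} {P₁} φ₂ ψ₁)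
  , substMap {O₂} {O₁} {P₂} {P₁} ψ₂ ψ₁

_∘ₘ_ : ∀ {A B C} → Hom B C → Hom A B → Hom A C
(φ , ψ) ∘ₘ (φ' , ψ') = (λ x → φ (φ' x)) , (λ x → ψ (ψ' x))

idₘ : ∀ {A} → Hom A A
idₘ {M , O} = idMap {M} , idMap {O}

𝕀 : Obj
𝕀 = One , X

assocᴿ : ∀ {a b c} → Hom ((a ∗ b) ∗ c) (a ∗ (b ∗ c))
assocᴿ {M₁ , O₁} {M₂ , O₂} {M₃ , O₃} =
    (λ x → prodMap {M₁} {(M₂ ⊚ O₁) · (M₃ ⊚ (O₂ ⊚ O₁))}
                   {M₁} {(M₂ · (M₃ ⊚ O₂)) ⊚ O₁}
             (idMap {M₁})
             (λ y → ⊚-distrib⁻ {M₂} {M₃ ⊚ O₂} {O₁}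
                      (prodMap {M₂ ⊚ O₁} {M₃ ⊚ (O₂ ⊚ O₁)}
                               {M₂ ⊚ O₁} {(M₃ ⊚ O₂) ⊚ O₁}
                               (idMap {M₂ ⊚ O₁}) (⊚-assoc⁻ {M₃} {O₂} {O₁}) y))
             (·-assoc {M₁} {M₂ ⊚ O₁} {M₃ ⊚ (O₂ ⊚ O₁)} x))
  , ⊚-assoc⁻ {O₃} {O₂} {O₁}

unitˡᴿ⁻ : ∀ {a} → Hom a (𝕀 ∗ a)
unitˡᴿ⁻ {M , O} = ι1· {M} , ι⊚X {O}

unitʳᴿ⁻ : ∀ {a} → Hom a (a ∗ 𝕀)
unitʳᴿ⁻ {M , O} = ι·1 {M} {O} , ιX⊚ {O}

_≋_ : ∀ {A B} → Hom A B → Hom A B → Set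
_≋_ {M₁ , O₁} {M₂ , O₂} (φ , ψ) (φ' , ψ') =
  (∀ {U} (x : F M₁ U) → _≈_ M₂ (φ x) (φ' x))
  × (∀ {U} (x : F O₁ U) → _≈_ O₂ (ψ x) (ψ' x))

IsHom : (A B : Obj) → Hom A B → Set
IsHom (M₁ , O₁) (M₂ , O₂) (φ , ψ) = IsMorphism M₁ M₂ φ × IsMorphism O₁ O₂ ψ

record IsMonop (a : Obj) (μ : Hom (a ∗ a) a) (u : Hom 𝕀 a) : Set where
  field
    μ-hom  : IsHom (a ∗ a) a μ
    u-hom  : IsHom 𝕀 a u
    assocM : _≋_ {(a ∗ a) ∗ a} {a}
               (_∘ₘ_ {(a ∗ a) ∗ a} {a ∗ a} {a} μ
                  (_∗ₘ_ {a ∗ a} {a} {a} {a} μ (idₘ {a})))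
               (_∘ₘ_ {(a ∗ a) ∗ a} {a ∗ (a ∗ a)} {a}
                  (_∘ₘ_ {a ∗ (a ∗ a)} {a ∗ a} {a} μ
                     (_∗ₘ_ {a} {a ∗ a} {a} {a} (idₘ {a}) μ))
                  (assocᴿ {a} {a} {a}))
    unitˡM : _≋_ {a} {a}
               (_∘ₘ_ {a} {𝕀 ∗ a} {a}
                  (_∘ₘ_ {𝕀 ∗ a} {a ∗ a} {a} μ
                     (_∗ₘ_ {𝕀} {a} {a} {a} u (idₘ {a})))
                  (unitˡᴿ⁻ {a}))
               (idₘ {a})
    unitʳM : _≋_ {a} {a}
               (_∘ₘ_ {a} {a ∗ 𝕀} {a}
                  (_∘ₘ_ {a ∗ 𝕀} {a ∗ a} {a} μ
                     (_∗ₘ_ {a} {𝕀} {a} {a} (idₘ {a}) u))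
                  (unitʳᴿ⁻ {a}))
               (idₘ {a})

module _ (𝔒 : Operad) where
  open Operad 𝔒

  chain : Map ((𝒪 ′) · ((𝒪 ′) ⊚ 𝒪)) ((𝒪 ⊚ 𝒪) ′)
  chain {V} (prod V₁ V₂ s m (subst I Bl g p r)) =
    subst (I ⊕ 𝟙c) Bl'' g'' p'' r
    where
      Bl'' : El (I ⊕ 𝟙c) → Code
      Bl'' (inj₁ i) = Bl i
      Bl'' (inj₂ _) = V₁ ⊕ 𝟙c
      p'' : (i : El (I ⊕ 𝟙c)) → Species.F O (Bl'' i)
      p'' (inj₁ i) = p i
      p'' (inj₂ _) = m
      ⊤×↔ : Σ ⊤ (λ _ → El V₁ ⊎ ⊤) ↔ (El V₁ ⊎ ⊤)
      ⊤×↔ = mk↔ₛ′ proj₂ (tt ,_) (λ _ → refl) (λ _ → refl)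
      g'' : Σ (El (I ⊕ 𝟙c)) (λ i → El (Bl'' i)) ↔ (El V ⊎ ⊤)
      g'' = (s ⊎-↔ (↔-id _))
          ↔-∘ ((⊎-comm _ _ ⊎-↔ (↔-id _))
          ↔-∘ (↔-sym (⊎-assoc _ _ _ _)
          ↔-∘ ((g ⊎-↔ ⊤×↔)
          ↔-∘ Σ-distribʳ-⊎)))

  -- ρ = η'  (through the chain rule),  𝔢 = e'  (through X' ≅ 1)
  ρ : Map ((𝒪 ′) · ((𝒪 ′) ⊚ 𝒪)) (𝒪 ′)
  ρ x = η (chain x)

  𝔢 : Map One (𝒪 ′)
  𝔢 {U} u = e (inj₂ tt , pt)
    where
      pt : ∀ b → b ≡ inj₂ tt
      pt (inj₁ v)  = ⊥-elim (u v)
      pt (inj₂ tt) = refl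

-- Differentiating the operad laws of 𝒪 at a marked point gives the monop laws of
-- (𝒪′ , 𝒪). Through the chain rule, an 𝒪′·𝒪′(𝒪)-structure is an 𝒪(𝒪)-structure in
-- which the marked point lies in the block carrying the left factor, so ρ = η′ is
-- η applied to it. Each monop law then becomes the corresponding operad law applied
-- to a suitably re-bracketed substitution structure, and the two sides agree up to
-- the equality of substitution structures, which η respects.
module Submission where

open import Defs
open import Data.Empty using (⊥)
open import Data.Unit using (⊤; tt)
open import Data.Sum using (_⊎_; inj₁; inj₂)
open import Data.Product using (Σ; _,_; proj₁)
open import Function.Bundles using (_↔_; Inverse; mk↔ₛ′)
open import Function.Construct.Composition using (_↔-∘_)
open import Function.Construct.Identity using (↔-id)
open import Data.Sum.Function.Propositional using (_⊎-↔_)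
open import Relation.Binary.PropositionalEquality using (_≡_; refl; sym; trans; cong)

open Inverse using (to; from; strictlyInverseˡ; strictlyInverseʳ)

⊥⊎⊤↔⊤ : (⊥ ⊎ ⊤) ↔ ⊤
⊥⊎⊤↔⊤ = mk↔ₛ′ (λ _ → tt) inj₂ (λ _ → refl) (λ { (inj₁ ()) ; (inj₂ tt) → refl })

Σ-⊎⊤-↔ : {A : Set} {P Q : A ⊎ ⊤ → Set} →
         (∀ a → P (inj₁ a) ↔ Q (inj₁ a)) → P (inj₂ tt) ↔ Q (inj₂ tt) →
         Σ (A ⊎ ⊤) P ↔ Σ (A ⊎ ⊤) Q
Σ-⊎⊤-↔ {A} {P} {Q} f g = mk↔ₛ′ forth back forth∘back back∘forth
  where
    forth : Σ (A ⊎ ⊤) P → Σ (A ⊎ ⊤) Q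
    forth (inj₁ a , b)  = inj₁ a , to (f a) b
    forth (inj₂ tt , b) = inj₂ tt , to g b
    back : Σ (A ⊎ ⊤) Q → Σ (A ⊎ ⊤) P
    back (inj₁ a , b)  = inj₁ a , from (f a) b
    back (inj₂ tt , b) = inj₂ tt , from g b
    forth∘back : ∀ y → forth (back y) ≡ y
    forth∘back (inj₁ a , b)  = cong (inj₁ a ,_) (strictlyInverseˡ (f a) b)
    forth∘back (inj₂ tt , b) = cong (inj₂ tt ,_) (strictlyInverseˡ g b)
    back∘forth : ∀ y → back (forth y) ≡ y
    back∘forth (inj₁ a , b)  = cong (inj₁ a ,_) (strictlyInverseʳ (f a) b)
    back∘forth (inj₂ tt , b) = cong (inj₂ tt ,_) (strictlyInverseʳ g b)

module Derivative (𝔒 : Operad) where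
  open Operad 𝔒
  open Species O using (tr-id)
  open IsMorphism η-morph renaming (resp to η-resp; natural to η-natural)
  open IsMorphism e-morph renaming (resp to e-resp; natural to e-natural)

  _≈₃_ : ∀ {U} → Subst₀ 𝒪 (𝒪 ⊚ 𝒪) U → Subst₀ 𝒪 (𝒪 ⊚ 𝒪) U → Set
  _≈₃_ = RawSpecies._≈_ (𝒪 ⊚ (𝒪 ⊚ 𝒪))

  η-inner : Map (𝒪 ⊚ (𝒪 ⊚ 𝒪)) 𝒪
  η-inner x = η (substMap {𝒪} {𝒪 ⊚ 𝒪} {𝒪} {𝒪} (idMap {𝒪}) η x)

  η-outer : Map ((𝒪 ⊚ 𝒪) ⊚ 𝒪) 𝒪
  η-outer x = η (substMap {𝒪 ⊚ 𝒪} {𝒪} {𝒪} {𝒪} η (idMap {𝒪}) x)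

  η-inner-resp : ∀ {U} {x y : Subst₀ 𝒪 (𝒪 ⊚ 𝒪) U} → x ≈₃ y → η-inner x ≡ η-inner y
  η-inner-resp {x = subst _ _ _ p _} (α , γ , glue≡ , inner≈ , outer≈) =
    η-resp (α , γ , glue≡ , (λ i → trans (sym (η-natural (γ i) (p i))) (η-resp (inner≈ i))) , outer≈)

  ⊚-assoc∘⊚-assoc⁻≈id : ∀ {U} (x : Subst₀ 𝒪 (𝒪 ⊚ 𝒪) U) →
                        ⊚-assoc {𝒪} {𝒪} {𝒪} (⊚-assoc⁻ {𝒪} {𝒪} {𝒪} x) ≈₃ x
  ⊚-assoc∘⊚-assoc⁻≈id (subst J K δ t s) =
    ↔-id _ , (λ j → Subst₀.glue (t j)) , (λ j b → refl) ,
    (λ j → ↔-id _ , (λ c → ↔-id _) , (λ c b → refl) , (λ c → tr-id _) , tr-id _) ,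
    tr-id s

  η-assoc⁻ : ∀ {U} (x : Subst₀ 𝒪 (𝒪 ⊚ 𝒪) U) →
             η-inner x ≡ η-outer (⊚-assoc⁻ {𝒪} {𝒪} {𝒪} x)
  η-assoc⁻ x = trans (sym (η-inner-resp (⊚-assoc∘⊚-assoc⁻≈id x)))
                     (sym (assoc (⊚-assoc⁻ {𝒪} {𝒪} {𝒪} x)))

  ρ-morph : IsMorphism ((𝒪 ′) · ((𝒪 ′) ⊚ 𝒪)) (𝒪 ′) (ρ 𝔒)
  IsMorphism.resp ρ-morph {x = prod _ _ _ _ (subst _ _ g _ _)} {prod _ _ s′ _ _}
    (α₁ , α₂ , split≡ , left≈ , (α , γ , glue≡ , inner≈ , outer≈)) =
    η-resp ((α ⊎-↔ ↔-id _) ,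
            (λ { (inj₁ i) → γ i ; (inj₂ tt) → α₁ ⊎-↔ ↔-id _ }) ,
            (λ { (inj₁ i) b → cong inj₁ (trans (cong (λ z → to s′ (inj₂ z)) (glue≡ i b))
                                              (split≡ (inj₂ (to g (i , b)))))
               ; (inj₂ tt) (inj₁ v) → cong inj₁ (split≡ (inj₁ v))
               ; (inj₂ tt) (inj₂ tt) → refl }) ,
            (λ { (inj₁ i) → inner≈ i ; (inj₂ tt) → left≈ }) ,
            outer≈)
  IsMorphism.natural ρ-morph β x@(prod V₁ V₂ s m y) =
    trans (η-resp {x = chain 𝔒 (prod V₁ V₂ (β ↔-∘ s) m y)}
                  {y = RawSpecies.tr (𝒪 ⊚ 𝒪) (β ⊎-↔ ↔-id _) (chain 𝔒 x)}
             (↔-id _ , (λ _ → ↔-id _) ,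
              (λ { (inj₁ i) b → refl ; (inj₂ tt) (inj₁ v) → refl ; (inj₂ tt) (inj₂ tt) → refl }) ,
              (λ { (inj₁ i) → tr-id _ ; (inj₂ tt) → tr-id _ }) , tr-id _))
          (η-natural (β ⊎-↔ ↔-id _) (chain 𝔒 x))

  𝔢-morph : IsMorphism One (𝒪 ′) (𝔢 𝔒)
  IsMorphism.resp 𝔢-morph _ = e-resp refl
  IsMorphism.natural 𝔢-morph f _ = trans (e-resp refl) (e-natural (f ⊎-↔ ↔-id _) _)

  a : Obj
  a = (𝒪 ′) , 𝒪

  μ : Hom (a ∗ a) a
  μ = ρ 𝔒 , η

  -- Both sides are η applied to a three-level tree: the left one after regrouping as
  -- an 𝒪(𝒪(𝒪))-structure (Y), the right one as an 𝒪(𝒪)(𝒪)-structure (Z) with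
  -- ⊚-assoc Z ≈ Y, so the operad associativity law closes the gap.
  ρ-assoc : ∀ {U} (x : RawSpecies.F (((𝒪 ′) · ((𝒪 ′) ⊚ 𝒪)) · ((𝒪 ′) ⊚ (𝒪 ⊚ 𝒪))) U) →
    proj₁ (_∘ₘ_ {(a ∗ a) ∗ a} {a ∗ a} {a} μ (_∗ₘ_ {a ∗ a} {a} {a} {a} μ (idₘ {a}))) x
    ≡ proj₁ (_∘ₘ_ {(a ∗ a) ∗ a} {a ∗ (a ∗ a)} {a}
                  (_∘ₘ_ {a ∗ (a ∗ a)} {a ∗ a} {a} μ (_∗ₘ_ {a} {a ∗ a} {a} {a} (idₘ {a}) μ))
                  (assocᴿ {a} {a} {a})) x
  ρ-assoc {U} x@(prod W V₃ s (prod V₁ V₂ t m (subst I B g p r)) (subst J C h q u)) =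
    trans lhs≡ (trans (sym (η-inner-resp regroup≈)) (sym (assoc Z)))
    where
      inner : Subst₀ 𝒪 𝒪 (W ⊕ 𝟙c)
      inner = chain 𝔒 (prod V₁ V₂ t m (subst I B g p r))
      lhs : Subst₀ 𝒪 𝒪 (U ⊕ 𝟙c)
      lhs = chain 𝔒 (prod W V₃ s (η inner) (subst J C h (λ j → η (q j)) u))
      blocks : (i : El (J ⊕ 𝟙c)) → Subst₀ 𝒪 𝒪 (Subst₀.B lhs i)
      blocks (inj₁ j)  = q j
      blocks (inj₂ tt) = inner
      Y : Subst₀ 𝒪 (𝒪 ⊚ 𝒪) (U ⊕ 𝟙c)
      Y = subst (Subst₀.I lhs) (Subst₀.B lhs) (Subst₀.glue lhs) blocks u
      A : Prod₀ (𝒪 ′) (((𝒪 ′) · ((𝒪 ′) ⊚ 𝒪)) ⊚ 𝒪) U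
      A = proj₁ (assocᴿ {a} {a} {a}) x
      rhs : Subst₀ 𝒪 𝒪 (U ⊕ 𝟙c)
      rhs = chain 𝔒 (prodMap {𝒪 ′} {((𝒪 ′) · ((𝒪 ′) ⊚ 𝒪)) ⊚ 𝒪} {𝒪 ′} {(𝒪 ′) ⊚ 𝒪}
                       (idMap {𝒪 ′})
                       (substMap {(𝒪 ′) · ((𝒪 ′) ⊚ 𝒪)} {𝒪} {𝒪 ′} {𝒪} (ρ 𝔒) (idMap {𝒪})) A)
      Z : Subst₀ (𝒪 ⊚ 𝒪) 𝒪 (U ⊕ 𝟙c)
      Z = subst (Subst₀.I rhs) (Subst₀.B rhs) (Subst₀.glue rhs) (Subst₀.inner rhs)
                (chain 𝔒 (Subst₀.outer (Prod₀.right A)))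
      lhs≡ : η lhs ≡ η-inner Y
      lhs≡ = η-resp (↔-id _ , (λ _ → ↔-id _) , (λ i b → refl) ,
                     (λ { (inj₁ j) → tr-id _ ; (inj₂ tt) → tr-id _ }) , tr-id _)
      regroup≈ : ⊚-assoc {𝒪} {𝒪} {𝒪} Z ≈₃ Y
      regroup≈ =
        ↔-id _ ,
        (λ { (inj₁ j)  → Subst₀.glue (q j)
           ; (inj₂ tt) → Subst₀.glue inner ↔-∘ Σ-⊎⊤-↔ (λ _ → ↔-id _) (↔-id _) }) ,
        (λ { (inj₁ j) b → refl
           ; (inj₂ tt) (inj₁ i , b) → refl
           ; (inj₂ tt) (inj₂ tt , inj₁ v) → refl
           ; (inj₂ tt) (inj₂ tt , inj₂ tt) → refl }) ,
        (λ { (inj₁ j)  → ↔-id _ , (λ c → ↔-id _) , (λ c b → refl) , (λ c → tr-id _) , tr-id _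
           ; (inj₂ tt) → ↔-id _ , (λ { (inj₁ i) → ↔-id _ ; (inj₂ tt) → ↔-id _ }) ,
                         (λ { (inj₁ i) b → refl ; (inj₂ tt) b → refl }) ,
                         (λ { (inj₁ i) → tr-id _ ; (inj₂ tt) → tr-id _ }) , tr-id _ }) ,
        tr-id u

  ρ-unitˡ : ∀ {U} (x : RawSpecies.F (𝒪 ′) U) →
    ρ 𝔒 (prodMap {One} {(𝒪 ′) ⊚ X} {𝒪 ′} {(𝒪 ′) ⊚ 𝒪} (𝔢 𝔒)
                 (substMap {𝒪 ′} {X} {𝒪 ′} {𝒪} (idMap {𝒪 ′}) e) (ι1· {𝒪 ′} x))
    ≡ x
  ρ-unitˡ x =
    trans (η-resp (↔-id _ ,
                   (λ { (inj₁ u) → ↔-id _ ; (inj₂ tt) → ⊥⊎⊤↔⊤ }) ,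
                   (λ { (inj₁ u) tt → refl ; (inj₂ tt) (inj₁ ()) ; (inj₂ tt) (inj₂ tt) → refl }) ,
                   (λ { (inj₁ u)  → trans (tr-id _) (e-resp refl)
                      ; (inj₂ tt) → trans (sym (e-natural ⊥⊎⊤↔⊤ _)) (e-resp refl) }) ,
                   tr-id x))
          (unitʳ x)

  ρ-unitʳ : ∀ {U} (x : RawSpecies.F (𝒪 ′) U) →
    ρ 𝔒 (prodMap {𝒪 ′} {One ⊚ 𝒪} {𝒪 ′} {(𝒪 ′) ⊚ 𝒪} (idMap {𝒪 ′})
                 (substMap {One} {𝒪} {𝒪 ′} {𝒪} (𝔢 𝔒) (idMap {𝒪})) (ι·1 {𝒪 ′} {𝒪} x))
    ≡ x
  ρ-unitʳ x =
    trans (η-resp (⊥⊎⊤↔⊤ ,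
                   (λ { (inj₁ ()) ; (inj₂ tt) → ↔-id _ }) ,
                   (λ { (inj₁ ()) _ ; (inj₂ tt) (inj₁ u) → refl ; (inj₂ tt) (inj₂ tt) → refl }) ,
                   (λ { (inj₁ ()) ; (inj₂ tt) → tr-id _ }) ,
                   trans (sym (e-natural ⊥⊎⊤↔⊤ _)) (e-resp refl)))
          (unitˡ x)

theorem6p2 : (𝔒 : Operad) →
    IsMonop ((Operad.𝒪 𝔒 ′) , Operad.𝒪 𝔒) (ρ 𝔒 , Operad.η 𝔒) (𝔢 𝔒 , Operad.e 𝔒)
theorem6p2 𝔒 = record
  { μ-hom  = ρ-morph , η-morph
  ; u-hom  = 𝔢-morph , e-morph
  ; assocM = ρ-assoc , η-assoc⁻
  ; unitˡM = ρ-unitˡ , unitʳ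
  ; unitʳM = ρ-unitʳ , unitˡ
  }
  where
    open Operad 𝔒
    open Derivative 𝔒
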